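{- For every $n\ge 1$, the linear extension diameter of the Boolean lattice $B_n$ is $\mathrm{led}(B_n)=2^{2n-2}-(n+1)\cdot 2^{n-2}$.
   Context: $B_n$ is the poset of all subsets of $[n]$ ordered by inclusion. The distance between two linear extensions of a finite poset $\mathcal{P}$ is the number of unordered pairs of elements of $\mathcal{P}$ appearing in different orders in them; the linear extension diameter $\mathrm{led}(\mathcal{P})$ is the maximum distance over all pairs of linear extensions of $\mathcal{P}$. -}

module Defs where

open import Data.Nat using (ℕ; zero; suc; _+_; _*_; _^_; _≤_; _<ᵇ_)
open import Data.Fin using (Fin; toℕ)
open import Data.Fin.Subset using (Subset; _⊆_; inside; outside)
open import Data.Vec using (Vec; []; _∷_)
open import Data.List using (List; []; _∷_; _++_; map; length; filterᵇ; cartesianProduct)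
open import Data.Bool using (Bool; _∧_)
open import Data.Product using (_×_; _,_; Σ; ∃)
open import Function.Definitions using (Bijective)
open import Relation.Binary.PropositionalEquality using (_≡_)

record LinExt (n : ℕ) : Set where
  field
    pos      : Subset n → Fin (2 ^ n)
    bij      : Bijective _≡_ _≡_ pos
    monotone : ∀ {A B : Subset n} → A ⊆ B → toℕ (pos A) ≤ toℕ (pos B)
open LinExt public

allSubsets : (n : ℕ) → List (Subset n)
allSubsets zero    = [] ∷ []
allSubsets (suc n) = map (outside ∷_) (allSubsets n) ++ map (inside ∷_) (allSubsets n)

-- (A , B) is discordant if A precedes B in L₁ but B precedes A in L₂.
-- Each unordered pair in different orders is counted exactly once.
discordant : ∀ {n} → LinExt n → LinExt n → Subset n × Subset n → Bool
discordant L₁ L₂ (A , B) =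
  (toℕ (pos L₁ A) <ᵇ toℕ (pos L₁ B)) ∧ (toℕ (pos L₂ B) <ᵇ toℕ (pos L₂ A))

dist : ∀ {n} → LinExt n → LinExt n → ℕ
dist {n} L₁ L₂ =
  length (filterᵇ (discordant L₁ L₂) (cartesianProduct (allSubsets n) (allSubsets n)))

IsLED : ℕ → ℕ → Set
IsLED n d = (Σ (LinExt n) λ L₁ → Σ (LinExt n) λ L₂ → dist L₁ L₂ ≡ d)
          × (∀ (L₁ L₂ : LinExt n) → dist L₁ L₂ ≤ d)

-- Fix two linear extensions of B_n and count their discordant pairs coordinate by coordinate. Pairs
-- agreeing in the first coordinate give two instances of the same problem on B_(n-1); in pairs
-- disagreeing there, that coordinate joins a block of k free coordinates on which the two sets are
-- complementary. Once only free coordinates are left, the sets X placed before their complement by the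
-- first extension form a down-set containing at most one of X and its complement, and dually for the
-- second extension an up-set; Harris' inequality bounds their intersection by 2^(k-2). The recursion
-- that results solves to 4 led(B_n) ≤ 4^n − (n+1) 2^n, and the two binary orders with opposite
-- significance of the coordinates (lexicographic and colexicographic) attain it.

module Submission where

open import Algebra.Properties.CommutativeSemigroup using (interchange)
open import Data.Bool using (Bool; T; true; false; _∧_; not)
open import Data.Bool.Properties using (T-≡; ⇔→≡; ¬-not; not-involutive)
open import Data.Empty using (⊥-elim)
open import Data.Fin using (toℕ; fromℕ<)
open import Data.Fin.Properties using (toℕ-fromℕ<; fromℕ<-injective; toℕ-injective; toℕ<n)
open import Data.Fin.Subset using (Subset; _⊆_; inside; outside; ∁)
open import Data.Fin.Subset.Properties
  using (⊆-refl; drop-∷-⊆; out⊆; in⊆in; s⊆s; p⊆q⇒∁p⊇∁q)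
open import Data.List using (List; []; _∷_; _++_; map; length; filterᵇ; cartesianProduct)
open import Data.List.Properties using (map-++; map-∘; map-cong)
open import Data.Nat
  using (ℕ; zero; suc; _+_; _*_; _^_; _∸_; _≤_; _<_; _<ᵇ_; _≡ᵇ_; z≤n; s≤s; ⌊_/2⌋)
open import Data.Nat.ListAction using (sum)
open import Data.Nat.ListAction.Properties using (sum-++)
open import Data.Nat.Properties
open import Data.Nat.Tactic.RingSolver using (solve-∀)
open import Data.Product using (Σ; _×_; _,_; ∃)
open import Data.Vec using ([]; _∷_; here)
import Data.Vec.Properties as Vec
open import Function using (_∘_; _⇔_; mk⇔; Equivalence)
import Function.Properties.Equivalence as ⇔
open import Relation.Binary.PropositionalEquality
open import Relation.Nullary using (¬_; yes; no)
open import Defs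

private
  variable
    A B : Set

𝟙 : Bool → ℕ
𝟙 true  = 1
𝟙 false = 0

𝟙-mono : ∀ {a b} → (T a → T b) → 𝟙 a ≤ 𝟙 b
𝟙-mono {false}         _   = z≤n
𝟙-mono {true}  {true}  _   = ≤-refl
𝟙-mono {true}  {false} a⇒b = ⊥-elim (a⇒b _)

𝟙≤1 : ∀ x → 𝟙 x ≤ 1
𝟙≤1 false = z≤n
𝟙≤1 true  = s≤s z≤n

∑ : List A → (A → ℕ) → ℕ
∑ xs f = sum (map f xs)

syntax ∑ xs (λ x → e) = ∑[ x ∈ xs ] e

∑-++ : ∀ (xs ys : List A) f → ∑ (xs ++ ys) f ≡ ∑ xs f + ∑ ys f
∑-++ xs ys f = trans (cong sum (map-++ f xs ys)) (sum-++ (map f xs) (map f ys))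

∑-map : ∀ (g : A → B) xs f → ∑ (map g xs) f ≡ ∑ xs (f ∘ g)
∑-map g xs f = cong sum (sym (map-∘ xs))

∑-cong : ∀ (xs : List A) {f g} → (∀ x → f x ≡ g x) → ∑ xs f ≡ ∑ xs g
∑-cong xs f≗g = cong sum (map-cong f≗g xs)

∑-mono : ∀ (xs : List A) {f g} → (∀ x → f x ≤ g x) → ∑ xs f ≤ ∑ xs g
∑-mono []       _   = z≤n
∑-mono (x ∷ xs) f≤g = +-mono-≤ (f≤g x) (∑-mono xs f≤g)

∑-+ : ∀ (xs : List A) f g → ∑[ x ∈ xs ] (f x + g x) ≡ ∑ xs f + ∑ xs g
∑-+ []       f g = refl
∑-+ (x ∷ xs) f g = trans (cong (f x + g x +_) (∑-+ xs f g))
                         (interchange +-commutativeSemigroup (f x) (g x) _ _)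

∑-zero : ∀ (xs : List A) → ∑[ x ∈ xs ] 0 ≡ 0
∑-zero []       = refl
∑-zero (x ∷ xs) = ∑-zero xs

∑-cartesianProduct : ∀ (xs : List A) (ys : List B) f →
  ∑ (cartesianProduct xs ys) f ≡ ∑[ x ∈ xs ] ∑[ y ∈ ys ] f (x , y)
∑-cartesianProduct []       ys f = refl
∑-cartesianProduct (x ∷ xs) ys f =
  trans (∑-++ (map (x ,_) ys) _ f) (cong₂ _+_ (∑-map (x ,_) ys f) (∑-cartesianProduct xs ys f))

length-filterᵇ : ∀ (p : A → Bool) xs → length (filterᵇ p xs) ≡ ∑[ x ∈ xs ] 𝟙 (p x)
length-filterᵇ p []       = refl
length-filterᵇ p (x ∷ xs) with p x
... | true  = cong suc (length-filterᵇ p xs)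
... | false = length-filterᵇ p xs

𝒫 : (n : ℕ) → List (Subset n)
𝒫 = allSubsets

∑𝒫-suc : ∀ n (f : Subset (suc n) → ℕ) →
  ∑ (𝒫 (suc n)) f ≡ ∑[ A ∈ 𝒫 n ] f (outside ∷ A) + ∑[ A ∈ 𝒫 n ] f (inside ∷ A)
∑𝒫-suc n f = trans (∑-++ (map (outside ∷_) (𝒫 n)) (map (inside ∷_) (𝒫 n)) f)
                   (cong₂ _+_ (∑-map _ (𝒫 n) f) (∑-map _ (𝒫 n) f))

∑𝒫-1 : ∀ n → ∑[ A ∈ 𝒫 n ] 1 ≡ 2 ^ n
∑𝒫-1 zero    = refl
∑𝒫-1 (suc n) = begin
  ∑[ A ∈ 𝒫 (suc n) ] 1             ≡⟨ ∑𝒫-suc n _ ⟩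
  ∑[ A ∈ 𝒫 n ] 1 + ∑[ A ∈ 𝒫 n ] 1  ≡⟨ cong₂ _+_ (∑𝒫-1 n) (∑𝒫-1 n) ⟩
  2 ^ n + 2 ^ n                    ≡⟨ cong (2 ^ n +_) (sym (+-identityʳ (2 ^ n))) ⟩
  2 ^ suc n                        ∎
  where open ≡-Reasoning

∁-involutive : ∀ {n} (X : Subset n) → ∁ (∁ X) ≡ X
∁-involutive X =
  trans (sym (Vec.map-∘ not not X)) (trans (Vec.map-cong not-involutive X) (Vec.map-id X))

∑𝒫-∁ : ∀ n (f : Subset n → ℕ) → ∑[ X ∈ 𝒫 n ] f (∁ X) ≡ ∑ (𝒫 n) f
∑𝒫-∁ zero    f = refl
∑𝒫-∁ (suc n) f = begin
  ∑[ X ∈ 𝒫 (suc n) ] f (∁ X)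
    ≡⟨ ∑𝒫-suc n _ ⟩
  ∑[ X ∈ 𝒫 n ] f (inside ∷ ∁ X) + ∑[ X ∈ 𝒫 n ] f (outside ∷ ∁ X)
    ≡⟨ cong₂ _+_ (∑𝒫-∁ n (f ∘ (inside ∷_))) (∑𝒫-∁ n (f ∘ (outside ∷_))) ⟩
  ∑[ X ∈ 𝒫 n ] f (inside ∷ X) + ∑[ X ∈ 𝒫 n ] f (outside ∷ X)
    ≡⟨ +-comm (∑[ X ∈ 𝒫 n ] f (inside ∷ X)) _ ⟩
  ∑[ X ∈ 𝒫 n ] f (outside ∷ X) + ∑[ X ∈ 𝒫 n ] f (inside ∷ X)
    ≡⟨ sym (∑𝒫-suc n f) ⟩
  ∑ (𝒫 (suc n)) f ∎
  where open ≡-Reasoning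

∑𝒫² : ∀ n → (Subset n → Subset n → ℕ) → ℕ
∑𝒫² n f = ∑[ A ∈ 𝒫 n ] ∑[ B ∈ 𝒫 n ] f A B

∑𝒫²-cong : ∀ n {f g : Subset n → Subset n → ℕ} →
  (∀ A B → f A B ≡ g A B) → ∑𝒫² n f ≡ ∑𝒫² n g
∑𝒫²-cong n f≗g = ∑-cong (𝒫 n) (λ A → ∑-cong (𝒫 n) (f≗g A))

∑𝒫²-+ : ∀ n (f g : Subset n → Subset n → ℕ) →
  ∑𝒫² n (λ A B → f A B + g A B) ≡ ∑𝒫² n f + ∑𝒫² n g
∑𝒫²-+ n f g = trans (∑-cong (𝒫 n) (λ A → ∑-+ (𝒫 n) (f A) (g A))) (∑-+ (𝒫 n) _ _)

∑𝒫²-zero : ∀ n → ∑𝒫² n (λ _ _ → 0) ≡ 0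
∑𝒫²-zero n = trans (∑-cong (𝒫 n) (λ _ → ∑-zero (𝒫 n))) (∑-zero (𝒫 n))

∑𝒫²-suc : ∀ n (f : Subset (suc n) → Subset (suc n) → ℕ) → ∑𝒫² (suc n) f ≡
    (∑𝒫² n (λ A B → f (outside ∷ A) (outside ∷ B)) + ∑𝒫² n (λ A B → f (outside ∷ A) (inside ∷ B)))
  + (∑𝒫² n (λ A B → f (inside ∷ A) (outside ∷ B))  + ∑𝒫² n (λ A B → f (inside ∷ A) (inside ∷ B)))
∑𝒫²-suc n f = trans (∑𝒫-suc n (λ A → ∑ (𝒫 (suc n)) (f A))) (cong₂ _+_ (split outside) (split inside))
  where
  split : ∀ x → ∑[ A ∈ 𝒫 n ] ∑ (𝒫 (suc n)) (f (x ∷ A)) ≡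
    ∑𝒫² n (λ A B → f (x ∷ A) (outside ∷ B)) + ∑𝒫² n (λ A B → f (x ∷ A) (inside ∷ B))
  split x = trans (∑-cong (𝒫 n) (λ A → ∑𝒫-suc n (f (x ∷ A))))
                  (∑-+ (𝒫 n) (λ A → ∑[ B ∈ 𝒫 n ] f (x ∷ A) (outside ∷ B))
                             (λ A → ∑[ B ∈ 𝒫 n ] f (x ∷ A) (inside ∷ B)))

-- Harris' inequality

count : ∀ k → (Subset k → Bool) → ℕ
count k g = ∑[ X ∈ 𝒫 k ] 𝟙 (g X)

count-mono : ∀ k {g h : Subset k → Bool} → (∀ X → T (g X) → T (h X)) → count k g ≤ count k h
count-mono k g⇒h = ∑-mono (𝒫 k) (λ X → 𝟙-mono (g⇒h X))

Downset Upset : ∀ {k} → (Subset k → Bool) → Set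
Downset g = ∀ {X Y} → X ⊆ Y → T (g Y) → T (g X)
Upset   h = ∀ {X Y} → X ⊆ Y → T (h X) → T (h Y)

chebyshev₂ : ∀ {a₀ a₁ b₀ b₁} → a₁ ≤ a₀ → b₀ ≤ b₁ →
  2 * (a₀ * b₀ + a₁ * b₁) ≤ (a₀ + a₁) * (b₀ + b₁)
chebyshev₂ {a₁ = a₁} {b₀} a₁≤a₀ b₀≤b₁
  with m≤n⇒∃[o]m+o≡n a₁≤a₀ | m≤n⇒∃[o]m+o≡n b₀≤b₁
... | s , refl | t , refl =
  subst (2 * ((a₁ + s) * b₀ + a₁ * (b₀ + t)) ≤_) (sym (expand a₁ s b₀ t)) (m≤m+n _ (s * t))
  where
  expand : ∀ a s b t → (a + s + a) * (b + (b + t)) ≡ 2 * ((a + s) * b + a * (b + t)) + s * t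
  expand = solve-∀

-- Splitting off the first coordinate, the slices of g shrink and those of h grow, which is exactly
-- the hypothesis of chebyshev₂.
harris : ∀ k (g h : Subset k → Bool) → Downset g → Upset h →
  2 ^ k * count k (λ X → g X ∧ h X) ≤ count k g * count k h
harris zero g h _ _ with g [] | h []
... | true  | true  = ≤-refl
... | true  | false = z≤n
... | false | _     = z≤n
harris (suc k) g h down up = begin
  2 ^ suc k * count (suc k) (λ X → g X ∧ h X)
    ≡⟨ cong (2 ^ suc k *_) (∑𝒫-suc k _) ⟩
  2 * 2 ^ k * (count k (λ X → g₀ X ∧ h₀ X) + count k (λ X → g₁ X ∧ h₁ X))
    ≡⟨ distrib (2 ^ k) _ _ ⟩
  2 * (2 ^ k * count k (λ X → g₀ X ∧ h₀ X) + 2 ^ k * count k (λ X → g₁ X ∧ h₁ X))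
    ≤⟨ *-monoʳ-≤ 2 (+-mono-≤ (harris k g₀ h₀ (down ∘ s⊆s) (up ∘ s⊆s))
                             (harris k g₁ h₁ (down ∘ s⊆s) (up ∘ s⊆s))) ⟩
  2 * (count k g₀ * count k h₀ + count k g₁ * count k h₁)
    ≤⟨ chebyshev₂ (count-mono k (λ _ → down (out⊆ ⊆-refl)))
                  (count-mono k (λ _ → up (out⊆ ⊆-refl))) ⟩
  (count k g₀ + count k g₁) * (count k h₀ + count k h₁)
    ≡⟨ sym (cong₂ _*_ (∑𝒫-suc k _) (∑𝒫-suc k _)) ⟩
  count (suc k) g * count (suc k) h ∎
  where
  open ≤-Reasoning
  g₀ g₁ h₀ h₁ : Subset k → Bool
  g₀ = g ∘ (outside ∷_)
  g₁ = g ∘ (inside ∷_)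
  h₀ = h ∘ (outside ∷_)
  h₁ = h ∘ (inside ∷_)
  distrib : ∀ x y z → 2 * x * (y + z) ≡ 2 * (x * y + x * z)
  distrib = solve-∀

AntipodalFree : ∀ {k} → (Subset k → Bool) → Set
AntipodalFree f = ∀ X → ¬ (T (f X) × T (f (∁ X)))

antipodalFree⇒2*count≤2^ : ∀ k {f} → AntipodalFree f → 2 * count k f ≤ 2 ^ k
antipodalFree⇒2*count≤2^ k {f} free = begin
  2 * count k f                          ≡⟨ cong (count k f +_) (+-identityʳ _) ⟩
  count k f + count k f                  ≡⟨ cong (count k f +_) (sym (∑𝒫-∁ k (𝟙 ∘ f))) ⟩
  count k f + count k (f ∘ ∁)            ≡⟨ sym (∑-+ (𝒫 k) _ _) ⟩
  ∑[ X ∈ 𝒫 k ] (𝟙 (f X) + 𝟙 (f (∁ X)))  ≤⟨ ∑-mono (𝒫 k) atMostOne ⟩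
  ∑[ X ∈ 𝒫 k ] 1                         ≡⟨ ∑𝒫-1 k ⟩
  2 ^ k                                  ∎
  where
  open ≤-Reasoning
  atMostOne : ∀ X → 𝟙 (f X) + 𝟙 (f (∁ X)) ≤ 1
  atMostOne X with f X in fX | f (∁ X) in f∁X
  ... | false | false = z≤n
  ... | false | true  = ≤-refl
  ... | true  | false = ≤-refl
  ... | true  | true  = ⊥-elim (free X (subst T (sym fX) _ , subst T (sym f∁X) _))

-- Crossings and the upper bound

inside∷⊈outside∷ : ∀ {n} {p q : Subset n} → ¬ (inside ∷ p ⊆ outside ∷ q)
inside∷⊈outside∷ p⊆q with p⊆q here
... | ()

∷-⊆-∷ : ∀ {n m x y} {p q : Subset n} {p′ q′ : Subset m} →
  x ∷ p ⊆ y ∷ q → p′ ⊆ q′ → x ∷ p′ ⊆ y ∷ q′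
∷-⊆-∷ {x = outside}               _   p′⊆q′ = out⊆ p′⊆q′
∷-⊆-∷ {x = inside}  {y = outside} p⊆q _     = ⊥-elim (inside∷⊈outside∷ p⊆q)
∷-⊆-∷ {x = inside}  {y = inside}  _   p′⊆q′ = in⊆in p′⊆q′

Monotone₂ : ∀ {n k} → (Subset n → Subset k → ℕ) → Set
Monotone₂ p = ∀ {A A′ X X′} → A ⊆ A′ → X ⊆ X′ → p A X ≤ p A′ X′

restrict : ∀ {n k} → Bool → (Subset (suc n) → Subset k → ℕ) → Subset n → Subset k → ℕ
restrict x p A X = p (x ∷ A) X

shift : ∀ {n k} → (Subset (suc n) → Subset k → ℕ) → Subset n → Subset (suc k) → ℕ
shift p A (x ∷ X) = p (x ∷ A) X

restrict-monotone : ∀ {n k} x {p : Subset (suc n) → Subset k → ℕ} →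
  Monotone₂ p → Monotone₂ (restrict x p)
restrict-monotone x mono A⊆A′ X⊆X′ = mono (s⊆s A⊆A′) X⊆X′

shift-monotone : ∀ {n k} {p : Subset (suc n) → Subset k → ℕ} → Monotone₂ p → Monotone₂ (shift p)
shift-monotone mono {X = _ ∷ _} {X′ = _ ∷ _} A⊆A′ xX⊆xX′ =
  mono (∷-⊆-∷ xX⊆xX′ A⊆A′) (drop-∷-⊆ xX⊆xX′)

-- (A , X) and (B , ∁ X) encode the sets A ∪ X and B ∪ ∁ X of B_(n+k): a crossing is a discordant pair
-- that disagrees in each of the last k coordinates.
crossing : ∀ {n k} (p₁ p₂ : Subset n → Subset k → ℕ) → Subset n → Subset n → Subset k → Bool
crossing p₁ p₂ A B X = (p₁ A X <ᵇ p₁ B (∁ X)) ∧ (p₂ B (∁ X) <ᵇ p₂ A X)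

crossings : ∀ n k → (p₁ p₂ : Subset n → Subset k → ℕ) → ℕ
crossings n k p₁ p₂ = ∑𝒫² n λ A B → count k (crossing p₁ p₂ A B)

crossings-suc : ∀ n k (p₁ p₂ : Subset (suc n) → Subset k → ℕ) →
  crossings (suc n) k p₁ p₂ ≡
    crossings n k (restrict outside p₁) (restrict outside p₂)
  + crossings n k (restrict inside p₁) (restrict inside p₂)
  + crossings n (suc k) (shift p₁) (shift p₂)
crossings-suc n k p₁ p₂ = begin
  crossings (suc n) k p₁ p₂
    ≡⟨ ∑𝒫²-suc n _ ⟩
  (c outside outside + c outside inside) + (c inside outside + c inside inside)
    ≡⟨ regroup (c outside outside) _ _ _ ⟩
  c outside outside + c inside inside + (c outside inside + c inside outside)
    ≡⟨ cong (c outside outside + c inside inside +_) (sym shifted) ⟩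
  crossings n k (restrict outside p₁) (restrict outside p₂)
  + crossings n k (restrict inside p₁) (restrict inside p₂)
  + crossings n (suc k) (shift p₁) (shift p₂) ∎
  where
  open ≡-Reasoning
  c : Bool → Bool → ℕ
  c x y = ∑𝒫² n λ A B → count k (crossing p₁ p₂ (x ∷ A) (y ∷ B))
  regroup : ∀ a b c d → (a + b) + (c + d) ≡ a + d + (b + c)
  regroup = solve-∀
  shifted : crossings n (suc k) (shift p₁) (shift p₂) ≡ c outside inside + c inside outside
  shifted = trans (∑𝒫²-cong n (λ A B → ∑𝒫-suc k _))
                  (∑𝒫²-+ n (λ A B → count k (crossing p₁ p₂ (outside ∷ A) (inside ∷ B)))
                           (λ A B → count k (crossing p₁ p₂ (inside ∷ A) (outside ∷ B))))

⌊2^_/4⌋ : ℕ → ℕ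
⌊2^ zero /4⌋        = 0
⌊2^ suc zero /4⌋    = 0
⌊2^ suc (suc k) /4⌋ = 2 ^ k

4*m≤2^k⇒m≤⌊2^k/4⌋ : ∀ k {m} → 4 * m ≤ 2 ^ k → m ≤ ⌊2^ k /4⌋
4*m≤2^k⇒m≤⌊2^k/4⌋ zero          {m} 4m≤1 =
  ≤-pred (*-cancelˡ-< 4 m 1 (≤-<-trans 4m≤1 (s≤s (s≤s z≤n))))
4*m≤2^k⇒m≤⌊2^k/4⌋ (suc zero)    {m} 4m≤2 =
  ≤-pred (*-cancelˡ-< 4 m 1 (≤-<-trans 4m≤2 (s≤s (s≤s (s≤s z≤n)))))
4*m≤2^k⇒m≤⌊2^k/4⌋ (suc (suc k)) {m} 4m≤4·2^k =
  *-cancelˡ-≤ 4 (subst (4 * m ≤_) (sym (*-assoc 2 2 (2 ^ k))) 4m≤4·2^k)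

correlated-halves⇒4*≤2^ : ∀ k {c a b} →
  2 ^ k * c ≤ a * b → 2 * a ≤ 2 ^ k → 2 * b ≤ 2 ^ k → 4 * c ≤ 2 ^ k
correlated-halves⇒4*≤2^ k {c} {a} {b} correlated 2a≤2^k 2b≤2^k = *-cancelˡ-≤ (2 ^ k) (begin
  2 ^ k * (4 * c)    ≡⟨ x*[4*y]≡4*[x*y] (2 ^ k) c ⟩
  4 * (2 ^ k * c)    ≤⟨ *-monoʳ-≤ 4 correlated ⟩
  4 * (a * b)        ≡⟨ 4*[x*y]≡[2*x]*[2*y] a b ⟩
  (2 * a) * (2 * b)  ≤⟨ *-mono-≤ 2a≤2^k 2b≤2^k ⟩
  2 ^ k * 2 ^ k      ∎)
  where
  open ≤-Reasoning
  instance _ = m^n≢0 2 k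
  x*[4*y]≡4*[x*y] : ∀ x y → x * (4 * y) ≡ 4 * (x * y)
  x*[4*y]≡4*[x*y] = solve-∀
  4*[x*y]≡[2*x]*[2*y] : ∀ x y → 4 * (x * y) ≡ (2 * x) * (2 * y)
  4*[x*y]≡[2*x]*[2*y] = solve-∀

crossings-zero : ∀ k {p₁ p₂ : Subset 0 → Subset k → ℕ} → Monotone₂ p₁ → Monotone₂ p₂ →
  crossings 0 k p₁ p₂ ≤ ⌊2^ k /4⌋
crossings-zero k {p₁} {p₂} mono₁ mono₂ =
  subst (_≤ ⌊2^ k /4⌋) (sym (trans (+-identityʳ _) (+-identityʳ _)))
    (4*m≤2^k⇒m≤⌊2^k/4⌋ k
      (correlated-halves⇒4*≤2^ k {a = count k g} {count k h} (harris k g h g-down h-up)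
        (antipodalFree⇒2*count≤2^ k g-free) (antipodalFree⇒2*count≤2^ k h-free)))
  where
  g h : Subset k → Bool
  g X = p₁ [] X <ᵇ p₁ [] (∁ X)
  h X = p₂ [] (∁ X) <ᵇ p₂ [] X
  g-down : Downset g
  g-down X⊆Y gY = <⇒<ᵇ (≤-<-trans (mono₁ (λ ()) X⊆Y)
                        (<-≤-trans (<ᵇ⇒< _ _ gY) (mono₁ (λ ()) (p⊆q⇒∁p⊇∁q X⊆Y))))
  h-up : Upset h
  h-up X⊆Y hX = <⇒<ᵇ (≤-<-trans (mono₂ (λ ()) (p⊆q⇒∁p⊇∁q X⊆Y))
                      (<-≤-trans (<ᵇ⇒< _ _ hX) (mono₂ (λ ()) X⊆Y)))
  g-free : AntipodalFree g
  g-free X (gX , g∁X) = <-asym (<ᵇ⇒< _ _ gX)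
    (subst (λ Z → p₁ [] (∁ X) < p₁ [] Z) (∁-involutive X) (<ᵇ⇒< _ _ g∁X))
  h-free : AntipodalFree h
  h-free X (hX , h∁X) = <-asym (<ᵇ⇒< _ _ hX)
    (subst (λ Z → p₂ [] Z < p₂ [] (∁ X)) (∁-involutive X) (<ᵇ⇒< _ _ h∁X))

crossingBound : ℕ → ℕ → ℕ
crossingBound zero    k = ⌊2^ k /4⌋
crossingBound (suc n) k = crossingBound n k + crossingBound n k + crossingBound n (suc k)

crossings≤crossingBound : ∀ n k {p₁ p₂ : Subset n → Subset k → ℕ} →
  Monotone₂ p₁ → Monotone₂ p₂ → crossings n k p₁ p₂ ≤ crossingBound n k
crossings≤crossingBound zero    k mono₁ mono₂ = crossings-zero k mono₁ mono₂
crossings≤crossingBound (suc n) k {p₁} {p₂} mono₁ mono₂ = begin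
  crossings (suc n) k p₁ p₂
    ≡⟨ crossings-suc n k p₁ p₂ ⟩
  crossings n k (restrict outside p₁) (restrict outside p₂)
  + crossings n k (restrict inside p₁) (restrict inside p₂)
  + crossings n (suc k) (shift p₁) (shift p₂)
    ≤⟨ +-mono-≤ (+-mono-≤ (bound (restrict-monotone outside mono₁) (restrict-monotone outside mono₂))
                          (bound (restrict-monotone inside mono₁) (restrict-monotone inside mono₂)))
                (crossings≤crossingBound n (suc k) (shift-monotone mono₁) (shift-monotone mono₂)) ⟩
  crossingBound (suc n) k ∎
  where
  open ≤-Reasoning
  bound = crossings≤crossingBound n k

rank : ∀ {n} → LinExt n → Subset n → Subset 0 → ℕ
rank L A _ = toℕ (pos L A)

rank-monotone : ∀ {n} (L : LinExt n) → Monotone₂ (rank L)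
rank-monotone L A⊆A′ _ = monotone L A⊆A′

dist-∑ : ∀ {n} (L₁ L₂ : LinExt n) → dist L₁ L₂ ≡ ∑𝒫² n (λ A B → 𝟙 (discordant L₁ L₂ (A , B)))
dist-∑ {n} L₁ L₂ = trans (length-filterᵇ (discordant L₁ L₂) (cartesianProduct (𝒫 n) (𝒫 n)))
                         (∑-cartesianProduct (𝒫 n) (𝒫 n) _)

dist≤crossingBound : ∀ {n} (L₁ L₂ : LinExt n) → dist L₁ L₂ ≤ crossingBound n 0
dist≤crossingBound {n} L₁ L₂ = begin
  dist L₁ L₂
    ≡⟨ dist-∑ L₁ L₂ ⟩
  ∑𝒫² n (λ A B → 𝟙 (discordant L₁ L₂ (A , B)))
    ≡⟨ ∑𝒫²-cong n (λ A B → sym (+-identityʳ _)) ⟩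
  crossings n 0 (rank L₁) (rank L₂)
    ≤⟨ crossings≤crossingBound n 0 (rank-monotone L₁) (rank-monotone L₂) ⟩
  crossingBound n 0 ∎
  where open ≤-Reasoning

crossingBound-2+ : ∀ n k → crossingBound n (suc (suc k)) ≡ 2 ^ k * 4 ^ n
crossingBound-2+ zero    k = sym (*-identityʳ (2 ^ k))
crossingBound-2+ (suc n) k = begin
  crossingBound n (2 + k) + crossingBound n (2 + k) + crossingBound n (3 + k)
    ≡⟨ cong₂ _+_ (cong₂ _+_ (crossingBound-2+ n k) (crossingBound-2+ n k)) (crossingBound-2+ n (suc k)) ⟩
  2 ^ k * 4 ^ n + 2 ^ k * 4 ^ n + 2 * 2 ^ k * 4 ^ n
    ≡⟨ regroup (2 ^ k) (4 ^ n) ⟩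
  2 ^ k * (4 * 4 ^ n) ∎
  where
  open ≡-Reasoning
  regroup : ∀ x y → x * y + x * y + 2 * x * y ≡ x * (4 * y)
  regroup = solve-∀

2*crossingBound-1+2^n≡4^n : ∀ n → 2 * crossingBound n 1 + 2 ^ n ≡ 4 ^ n
2*crossingBound-1+2^n≡4^n zero    = refl
2*crossingBound-1+2^n≡4^n (suc n) = begin
  2 * (c + c + crossingBound n 2) + 2 * 2 ^ n
    ≡⟨ cong (λ t → 2 * (c + c + t) + 2 * 2 ^ n) (crossingBound-2+ n 0) ⟩
  2 * (c + c + 1 * 4 ^ n) + 2 * 2 ^ n
    ≡⟨ cong (λ t → 2 * (c + c + 1 * t) + 2 * 2 ^ n) (sym IH) ⟩
  2 * (c + c + 1 * (2 * c + 2 ^ n)) + 2 * 2 ^ n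
    ≡⟨ regroup c (2 ^ n) ⟩
  4 * (2 * c + 2 ^ n)
    ≡⟨ cong (4 *_) IH ⟩
  4 * 4 ^ n ∎
  where
  open ≡-Reasoning
  c = crossingBound n 1
  IH = 2*crossingBound-1+2^n≡4^n n
  regroup : ∀ c x → 2 * (c + c + 1 * (2 * c + x)) + 2 * x ≡ 4 * (2 * c + x)
  regroup = solve-∀

4*crossingBound-0+[n+1]*2^n≡4^n : ∀ n → 4 * crossingBound n 0 + (n + 1) * 2 ^ n ≡ 4 ^ n
4*crossingBound-0+[n+1]*2^n≡4^n zero    = refl
4*crossingBound-0+[n+1]*2^n≡4^n (suc n) = begin
  4 * (c₀ + c₀ + c₁) + (suc n + 1) * (2 * 2 ^ n)
    ≡⟨ regroup c₀ c₁ n (2 ^ n) ⟩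
  2 * (4 * c₀ + (n + 1) * 2 ^ n) + 2 * (2 * c₁ + 2 ^ n)
    ≡⟨ cong₂ (λ a b → 2 * a + 2 * b) (4*crossingBound-0+[n+1]*2^n≡4^n n) (2*crossingBound-1+2^n≡4^n n) ⟩
  2 * 4 ^ n + 2 * 4 ^ n
    ≡⟨ sym (*-distribʳ-+ (4 ^ n) 2 2) ⟩
  4 * 4 ^ n ∎
  where
  open ≡-Reasoning
  c₀ = crossingBound n 0
  c₁ = crossingBound n 1
  regroup : ∀ c₀ c₁ n x →
    4 * (c₀ + c₀ + c₁) + (suc n + 1) * (2 * x) ≡ 2 * (4 * c₀ + (n + 1) * x) + 2 * (2 * c₁ + x)
  regroup = solve-∀

-- Lexicographic and colexicographic extensions

record Numbering (n : ℕ) : Set where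
  field
    code           : Subset n → ℕ
    code<2^n       : ∀ A → code A < 2 ^ n
    code-injective : ∀ {A B} → code A ≡ code B → A ≡ B
    decode         : ℕ → Subset n
    code∘decode    : ∀ {m} → m < 2 ^ n → code (decode m) ≡ m
    code-monotone  : ∀ {A B} → A ⊆ B → code A ≤ code B
open Numbering

toLinExt : ∀ {n} → Numbering n → LinExt n
toLinExt ν = record
  { pos      = λ A → fromℕ< (code<2^n ν A)
  ; bij      = (λ {A} {B} → code-injective ν ∘ fromℕ<-injective _ _ (code<2^n ν A) (code<2^n ν B))
             , (λ i → decode ν (toℕ i) , λ { refl →
                  toℕ-injective (trans (toℕ-fromℕ< _) (code∘decode ν (toℕ<n i))) })
  ; monotone = λ {A} {B} A⊆B → subst₂ _≤_ (sym (toℕ-fromℕ< (code<2^n ν A)))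
                                          (sym (toℕ-fromℕ< (code<2^n ν B))) (code-monotone ν A⊆B)
  }

lex : ∀ {n} → Subset n → ℕ
lex []                    = 0
lex         (outside ∷ A) = lex A
lex {suc n} (inside  ∷ A) = 2 ^ n + lex A

lex<2^n : ∀ {n} (A : Subset n) → lex A < 2 ^ n
lex<2^n []                    = s≤s z≤n
lex<2^n {suc n} (outside ∷ A) = <-≤-trans (lex<2^n A) (m≤m+n (2 ^ n) _)
lex<2^n {suc n} (inside  ∷ A) = +-monoʳ-< (2 ^ n) (<-≤-trans (lex<2^n A) (m≤m+n (2 ^ n) 0))

lex<2^n+ : ∀ {n} (A : Subset n) m → lex A < 2 ^ n + m
lex<2^n+ {n} A m = <-≤-trans (lex<2^n A) (m≤m+n (2 ^ n) m)

lex-injective : ∀ {n} {A B : Subset n} → lex A ≡ lex B → A ≡ B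
lex-injective {A = []}          {[]}          _  = refl
lex-injective {A = outside ∷ A} {outside ∷ B} eq = cong (outside ∷_) (lex-injective eq)
lex-injective {A = outside ∷ A} {inside  ∷ B} eq = ⊥-elim (<⇒≢ (lex<2^n+ A _) eq)
lex-injective {A = inside  ∷ A} {outside ∷ B} eq = ⊥-elim (<⇒≢ (lex<2^n+ B _) (sym eq))
lex-injective {suc n} {inside ∷ A} {inside ∷ B} eq =
  cong (inside ∷_) (lex-injective (+-cancelˡ-≡ (2 ^ n) _ _ eq))

lexDecode : ∀ n → ℕ → Subset n
lexDecode zero    _ = []
lexDecode (suc n) m with m <? 2 ^ n
... | yes _ = outside ∷ lexDecode n m
... | no  _ = inside  ∷ lexDecode n (m ∸ 2 ^ n)

lex∘lexDecode : ∀ n {m} → m < 2 ^ n → lex (lexDecode n m) ≡ m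
lex∘lexDecode zero    m<1 = sym (n<1⇒n≡0 m<1)
lex∘lexDecode (suc n) {m} m<2^[1+n] with m <? 2 ^ n
... | yes m<2^n = lex∘lexDecode n m<2^n
... | no  m≮2^n = trans (cong (2 ^ n +_) (lex∘lexDecode n m∸2^n<2^n)) (m+[n∸m]≡n 2^n≤m)
  where
  2^n≤m : 2 ^ n ≤ m
  2^n≤m = ≮⇒≥ m≮2^n
  m∸2^n<2^n : m ∸ 2 ^ n < 2 ^ n
  m∸2^n<2^n = subst (m ∸ 2 ^ n <_) (trans (m+n∸m≡n (2 ^ n) _) (+-identityʳ (2 ^ n)))
                    (∸-monoˡ-< m<2^[1+n] 2^n≤m)

lex-monotone : ∀ {n} {A B : Subset n} → A ⊆ B → lex A ≤ lex B
lex-monotone {A = []}          {[]}          _   = z≤n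
lex-monotone {A = outside ∷ A} {outside ∷ B} A⊆B = lex-monotone (drop-∷-⊆ A⊆B)
lex-monotone {A = outside ∷ A} {inside  ∷ B} _   = <⇒≤ (lex<2^n+ A _)
lex-monotone {A = inside  ∷ A} {outside ∷ B} A⊆B = ⊥-elim (inside∷⊈outside∷ A⊆B)
lex-monotone {suc n} {inside ∷ A} {inside ∷ B} A⊆B = +-monoʳ-≤ (2 ^ n) (lex-monotone (drop-∷-⊆ A⊆B))

lexNumbering : ∀ n → Numbering n
lexNumbering n = record
  { code = lex ; code<2^n = lex<2^n ; code-injective = lex-injective
  ; decode = lexDecode n ; code∘decode = lex∘lexDecode n ; code-monotone = lex-monotone }

colex : ∀ {n} → Subset n → ℕ
colex []      = 0
colex (x ∷ A) = 𝟙 x + 2 * colex A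

colex<2^n : ∀ {n} (A : Subset n) → colex A < 2 ^ n
colex<2^n []              = s≤s z≤n
colex<2^n {suc n} (x ∷ A) = ≤-trans (s≤s (+-monoˡ-≤ _ (𝟙≤1 x)))
  (subst (_≤ 2 * 2 ^ n) (*-suc 2 (colex A)) (*-monoʳ-≤ 2 (colex<2^n A)))

colex-injective : ∀ {n} {A B : Subset n} → colex A ≡ colex B → A ≡ B
colex-injective {A = []}          {[]}          _  = refl
colex-injective {A = outside ∷ A} {outside ∷ B} eq =
  cong (outside ∷_) (colex-injective (*-cancelˡ-≡ _ _ 2 eq))
colex-injective {A = outside ∷ A} {inside  ∷ B} eq = ⊥-elim (even≢odd (colex A) (colex B) eq)
colex-injective {A = inside  ∷ A} {outside ∷ B} eq = ⊥-elim (even≢odd (colex B) (colex A) (sym eq))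
colex-injective {A = inside  ∷ A} {inside  ∷ B} eq =
  cong (inside ∷_) (colex-injective (*-cancelˡ-≡ _ _ 2 (suc-injective eq)))

lowBit : ℕ → Bool
lowBit zero          = false
lowBit (suc zero)    = true
lowBit (suc (suc m)) = lowBit m

lowBit+2*⌊/2⌋ : ∀ m → 𝟙 (lowBit m) + 2 * ⌊ m /2⌋ ≡ m
lowBit+2*⌊/2⌋ zero          = refl
lowBit+2*⌊/2⌋ (suc zero)    = refl
lowBit+2*⌊/2⌋ (suc (suc m)) =
  trans (expand (𝟙 (lowBit m)) ⌊ m /2⌋) (cong (suc ∘ suc) (lowBit+2*⌊/2⌋ m))
  where
  expand : ∀ b q → b + 2 * suc q ≡ suc (suc (b + 2 * q))
  expand = solve-∀

colexDecode : ∀ n → ℕ → Subset n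
colexDecode zero    _ = []
colexDecode (suc n) m = lowBit m ∷ colexDecode n ⌊ m /2⌋

colex∘colexDecode : ∀ n {m} → m < 2 ^ n → colex (colexDecode n m) ≡ m
colex∘colexDecode zero    m<1 = sym (n<1⇒n≡0 m<1)
colex∘colexDecode (suc n) {m} m<2*2^n =
  trans (cong (λ q → 𝟙 (lowBit m) + 2 * q) (colex∘colexDecode n ⌊m/2⌋<2^n)) (lowBit+2*⌊/2⌋ m)
  where
  2*⌊m/2⌋≤m : 2 * ⌊ m /2⌋ ≤ m
  2*⌊m/2⌋≤m = subst (2 * ⌊ m /2⌋ ≤_) (lowBit+2*⌊/2⌋ m) (m≤n+m (2 * ⌊ m /2⌋) (𝟙 (lowBit m)))
  ⌊m/2⌋<2^n : ⌊ m /2⌋ < 2 ^ n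
  ⌊m/2⌋<2^n = *-cancelˡ-< 2 _ _ (≤-<-trans 2*⌊m/2⌋≤m m<2*2^n)

colex-monotone : ∀ {n} {A B : Subset n} → A ⊆ B → colex A ≤ colex B
colex-monotone {A = []}          {[]}          _   = z≤n
colex-monotone {A = outside ∷ A} {outside ∷ B} A⊆B = *-monoʳ-≤ 2 (colex-monotone (drop-∷-⊆ A⊆B))
colex-monotone {A = outside ∷ A} {inside  ∷ B} A⊆B =
  m≤n⇒m≤1+n (*-monoʳ-≤ 2 (colex-monotone (drop-∷-⊆ A⊆B)))
colex-monotone {A = inside  ∷ A} {outside ∷ B} A⊆B = ⊥-elim (inside∷⊈outside∷ A⊆B)
colex-monotone {A = inside  ∷ A} {inside  ∷ B} A⊆B = s≤s (*-monoʳ-≤ 2 (colex-monotone (drop-∷-⊆ A⊆B)))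

colexNumbering : ∀ n → Numbering n
colexNumbering n = record
  { code = colex ; code<2^n = colex<2^n ; code-injective = colex-injective
  ; decode = colexDecode n ; code∘decode = colex∘colexDecode n ; code-monotone = colex-monotone }

lexExt colexExt : ∀ n → LinExt n
lexExt   n = toLinExt (lexNumbering n)
colexExt n = toLinExt (colexNumbering n)

T⇔T→≡ : ∀ {a b} → T a ⇔ T b → a ≡ b
T⇔T→≡ a⇔b = ⇔→≡ (⇔.trans (⇔.sym T-≡) (⇔.trans a⇔b T-≡))

<ᵇ-cong : ∀ {m n p q} → (m < n → p < q) → (p < q → m < n) → (m <ᵇ n) ≡ (p <ᵇ q)
<ᵇ-cong {m} {n} {p} {q} ⇒ ⇐ = T⇔T→≡ (mk⇔ (<⇒<ᵇ ∘ ⇒ ∘ <ᵇ⇒< m n) (<⇒<ᵇ ∘ ⇐ ∘ <ᵇ⇒< p q))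

≡ᵇ-cong : ∀ {m n p q} → (m ≡ n → p ≡ q) → (p ≡ q → m ≡ n) → (m ≡ᵇ n) ≡ (p ≡ᵇ q)
≡ᵇ-cong {m} {n} {p} {q} ⇒ ⇐ =
  T⇔T→≡ (mk⇔ (≡⇒≡ᵇ p q ∘ ⇒ ∘ ≡ᵇ⇒≡ m n) (≡⇒≡ᵇ m n ∘ ⇐ ∘ ≡ᵇ⇒≡ p q))

<ᵇ-true : ∀ {m n} → m < n → (m <ᵇ n) ≡ true
<ᵇ-true = Equivalence.to T-≡ ∘ <⇒<ᵇ

<ᵇ-false : ∀ {m n} → ¬ m < n → (m <ᵇ n) ≡ false
<ᵇ-false {m} {n} m≮n = ¬-not (m≮n ∘ <ᵇ⇒< m n ∘ Equivalence.from T-≡)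

≡ᵇ-false : ∀ {m n} → m ≢ n → (m ≡ᵇ n) ≡ false
≡ᵇ-false {m} {n} m≢n = ¬-not (m≢n ∘ ≡ᵇ⇒≡ m n ∘ Equivalence.from T-≡)

+-<ᵇ-+ : ∀ c {m n} → (c + m <ᵇ c + n) ≡ (m <ᵇ n)
+-<ᵇ-+ zero    = refl
+-<ᵇ-+ (suc c) = +-<ᵇ-+ c

2*-<ᵇ-2* : ∀ m n → (2 * m <ᵇ 2 * n) ≡ (m <ᵇ n)
2*-<ᵇ-2* m n = <ᵇ-cong (*-cancelˡ-< 2 m n) (*-monoʳ-< 2)

1+2*-<ᵇ-2* : ∀ m n → (suc (2 * m) <ᵇ 2 * n) ≡ (m <ᵇ n)
1+2*-<ᵇ-2* m n = <ᵇ-cong (*-cancelˡ-< 2 m n ∘ <-trans (n<1+n (2 * m)))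
                         (λ m<n → subst (_≤ 2 * n) (*-suc 2 m) (*-monoʳ-≤ 2 m<n))

2*-<ᵇ-1+2* : ∀ m n → (2 * m <ᵇ suc (2 * n)) ≡ (m <ᵇ suc n)
2*-<ᵇ-1+2* m n = <ᵇ-cong {2 * m} {suc (2 * n)} {m} {suc n}
  (s≤s ∘ *-cancelˡ-≤ 2 ∘ ≤-pred) (s≤s ∘ *-monoʳ-≤ 2 ∘ ≤-pred)

2*-≡ᵇ-2* : ∀ m n → (2 * m ≡ᵇ 2 * n) ≡ (m ≡ᵇ n)
2*-≡ᵇ-2* m n = ≡ᵇ-cong (*-cancelˡ-≡ m n 2) (cong (2 *_))

𝟙-<ᵇ-suc : ∀ m n → 𝟙 (m <ᵇ suc n) ≡ 𝟙 (m <ᵇ n) + 𝟙 (m ≡ᵇ n)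
𝟙-<ᵇ-suc zero    zero    = refl
𝟙-<ᵇ-suc zero    (suc n) = refl
𝟙-<ᵇ-suc (suc m) zero    = refl
𝟙-<ᵇ-suc (suc m) (suc n) = 𝟙-<ᵇ-suc m n

-- Discordant pairs of the two extensions

colexTies colexInversions lexColexDiscordances : ℕ → ℕ
colexTies            n = ∑𝒫² n λ A B → 𝟙 (colex B ≡ᵇ colex A)
colexInversions      n = ∑𝒫² n λ A B → 𝟙 (colex B <ᵇ colex A)
lexColexDiscordances n = ∑𝒫² n λ A B → 𝟙 ((lex A <ᵇ lex B) ∧ (colex B <ᵇ colex A))

colexTies≡2^n : ∀ n → colexTies n ≡ 2 ^ n
colexTies≡2^n zero    = refl
colexTies≡2^n (suc n) = begin
  colexTies (suc n)
    ≡⟨ ∑𝒫²-suc n _ ⟩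
    (∑𝒫² n (λ A B → 𝟙 (2 * colex B ≡ᵇ 2 * colex A))
     + ∑𝒫² n (λ A B → 𝟙 (suc (2 * colex B) ≡ᵇ 2 * colex A)))
  + (∑𝒫² n (λ A B → 𝟙 (2 * colex B ≡ᵇ suc (2 * colex A)))
     + ∑𝒫² n (λ A B → 𝟙 (2 * colex B ≡ᵇ 2 * colex A)))
    ≡⟨ cong₂ _+_ (cong₂ _+_ ties odd≢even) (cong₂ _+_ even≢odd′ ties) ⟩
  (colexTies n + 0) + (0 + colexTies n)
    ≡⟨ cong (λ t → (t + 0) + t) (colexTies≡2^n n) ⟩
  (2 ^ n + 0) + 2 ^ n
    ≡⟨ +-comm (2 ^ n + 0) (2 ^ n) ⟩
  2 ^ suc n ∎
  where
  open ≡-Reasoning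
  ties : ∑𝒫² n (λ A B → 𝟙 (2 * colex B ≡ᵇ 2 * colex A)) ≡ colexTies n
  ties = ∑𝒫²-cong n (λ A B → cong 𝟙 (2*-≡ᵇ-2* (colex B) (colex A)))
  odd≢even : ∑𝒫² n (λ A B → 𝟙 (suc (2 * colex B) ≡ᵇ 2 * colex A)) ≡ 0
  odd≢even = trans (∑𝒫²-cong n (λ A B → cong 𝟙 (≡ᵇ-false (even≢odd (colex A) (colex B) ∘ sym))))
                   (∑𝒫²-zero n)
  even≢odd′ : ∑𝒫² n (λ A B → 𝟙 (2 * colex B ≡ᵇ suc (2 * colex A))) ≡ 0
  even≢odd′ = trans (∑𝒫²-cong n (λ A B → cong 𝟙 (≡ᵇ-false (even≢odd (colex B) (colex A)))))
                    (∑𝒫²-zero n)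

colexInversions-suc : ∀ n → colexInversions (suc n) ≡
  (colexInversions n + colexInversions n) + ((colexInversions n + colexTies n) + colexInversions n)
colexInversions-suc n =
  trans (∑𝒫²-suc n _) (cong₂ _+_ (cong₂ _+_ inversions odd<even) (cong₂ _+_ even<odd inversions))
  where
  inversions : ∑𝒫² n (λ A B → 𝟙 (2 * colex B <ᵇ 2 * colex A)) ≡ colexInversions n
  inversions = ∑𝒫²-cong n (λ A B → cong 𝟙 (2*-<ᵇ-2* (colex B) (colex A)))
  odd<even : ∑𝒫² n (λ A B → 𝟙 (suc (2 * colex B) <ᵇ 2 * colex A)) ≡ colexInversions n
  odd<even = ∑𝒫²-cong n (λ A B → cong 𝟙 (1+2*-<ᵇ-2* (colex B) (colex A)))
  even<odd : ∑𝒫² n (λ A B → 𝟙 (2 * colex B <ᵇ suc (2 * colex A)))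
           ≡ colexInversions n + colexTies n
  even<odd = trans (∑𝒫²-cong n (λ A B → trans (cong 𝟙 (2*-<ᵇ-1+2* (colex B) (colex A)))
                                              (𝟙-<ᵇ-suc (colex B) (colex A))))
                   (∑𝒫²-+ n _ _)

2*colexInversions+2^n≡4^n : ∀ n → 2 * colexInversions n + 2 ^ n ≡ 4 ^ n
2*colexInversions+2^n≡4^n zero    = refl
2*colexInversions+2^n≡4^n (suc n) = begin
  2 * colexInversions (suc n) + 2 ^ suc n
    ≡⟨ cong (λ e → 2 * e + 2 ^ suc n) (colexInversions-suc n) ⟩
  2 * ((e + e) + ((e + colexTies n) + e)) + 2 * 2 ^ n
    ≡⟨ cong (λ t → 2 * ((e + e) + ((e + t) + e)) + 2 * 2 ^ n) (colexTies≡2^n n) ⟩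
  2 * ((e + e) + ((e + 2 ^ n) + e)) + 2 * 2 ^ n
    ≡⟨ regroup e (2 ^ n) ⟩
  4 * (2 * e + 2 ^ n)
    ≡⟨ cong (4 *_) (2*colexInversions+2^n≡4^n n) ⟩
  4 ^ suc n ∎
  where
  open ≡-Reasoning
  e = colexInversions n
  regroup : ∀ e x → 2 * ((e + e) + ((e + x) + e)) + 2 * x ≡ 4 * (2 * e + x)
  regroup = solve-∀

colexInversions≡crossingBound-1 : ∀ n → colexInversions n ≡ crossingBound n 1
colexInversions≡crossingBound-1 n = *-cancelˡ-≡ _ _ 2 (+-cancelʳ-≡ (2 ^ n) _ _
  (trans (2*colexInversions+2^n≡4^n n) (sym (2*crossingBound-1+2^n≡4^n n))))

lexColexDiscordances-suc : ∀ n → lexColexDiscordances (suc n) ≡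
  (lexColexDiscordances n + colexInversions n) + (0 + lexColexDiscordances n)
lexColexDiscordances-suc n = trans (∑𝒫²-suc n _)
  (cong₂ _+_ (cong₂ _+_ outside-outside outside-inside) (cong₂ _+_ inside-outside inside-inside))
  where
  outside-outside : ∑𝒫² n (λ A B → 𝟙 ((lex A <ᵇ lex B) ∧ (2 * colex B <ᵇ 2 * colex A)))
                  ≡ lexColexDiscordances n
  outside-outside = ∑𝒫²-cong n (λ A B →
    cong (λ b → 𝟙 ((lex A <ᵇ lex B) ∧ b)) (2*-<ᵇ-2* (colex B) (colex A)))
  outside-inside : ∑𝒫² n (λ A B → 𝟙 ((lex A <ᵇ 2 ^ n + lex B) ∧ (suc (2 * colex B) <ᵇ 2 * colex A)))
                 ≡ colexInversions n
  outside-inside = ∑𝒫²-cong n (λ A B →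
    cong 𝟙 (cong₂ _∧_ (<ᵇ-true (lex<2^n+ A (lex B))) (1+2*-<ᵇ-2* (colex B) (colex A))))
  inside-outside : ∑𝒫² n (λ A B → 𝟙 ((2 ^ n + lex A <ᵇ lex B) ∧ (2 * colex B <ᵇ suc (2 * colex A))))
                 ≡ 0
  inside-outside = trans (∑𝒫²-cong n (λ A B →
      cong (λ b → 𝟙 (b ∧ (2 * colex B <ᵇ suc (2 * colex A))))
           (<ᵇ-false (<-asym (lex<2^n+ B (lex A))))))
    (∑𝒫²-zero n)
  inside-inside : ∑𝒫² n (λ A B → 𝟙 ((2 ^ n + lex A <ᵇ 2 ^ n + lex B) ∧ (2 * colex B <ᵇ 2 * colex A)))
                ≡ lexColexDiscordances n
  inside-inside = ∑𝒫²-cong n (λ A B →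
    cong 𝟙 (cong₂ _∧_ (+-<ᵇ-+ (2 ^ n)) (2*-<ᵇ-2* (colex B) (colex A))))

lexColexDiscordances≡crossingBound-0 : ∀ n → lexColexDiscordances n ≡ crossingBound n 0
lexColexDiscordances≡crossingBound-0 zero    = refl
lexColexDiscordances≡crossingBound-0 (suc n) = begin
  lexColexDiscordances (suc n)
    ≡⟨ lexColexDiscordances-suc n ⟩
  (lexColexDiscordances n + colexInversions n) + (0 + lexColexDiscordances n)
    ≡⟨ cong₂ (λ d e → (d + e) + d) (lexColexDiscordances≡crossingBound-0 n)
                                   (colexInversions≡crossingBound-1 n) ⟩
  (crossingBound n 0 + crossingBound n 1) + crossingBound n 0
    ≡⟨ regroup (crossingBound n 0) (crossingBound n 1) ⟩
  crossingBound n 0 + crossingBound n 0 + crossingBound n 1 ∎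
  where
  open ≡-Reasoning
  regroup : ∀ a b → (a + b) + a ≡ a + a + b
  regroup = solve-∀

dist-lexExt-colexExt : ∀ n → dist (lexExt n) (colexExt n) ≡ lexColexDiscordances n
dist-lexExt-colexExt n = trans (dist-∑ (lexExt n) (colexExt n)) (∑𝒫²-cong n λ A B →
  cong 𝟙 (cong₂ _∧_ (cong₂ _<ᵇ_ (toℕ-fromℕ< (lex<2^n A)) (toℕ-fromℕ< (lex<2^n B)))
                    (cong₂ _<ᵇ_ (toℕ-fromℕ< (colex<2^n B)) (toℕ-fromℕ< (colex<2^n A)))))

-- The formula also holds for n = 0.
theorem1 : ∀ (n : ℕ) → 1 ≤ n →
    ∃ λ (d : ℕ) → IsLED n d × (4 * d + (n + 1) * 2 ^ n ≡ 2 ^ (2 * n))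
theorem1 n _ = crossingBound n 0 , (attained , dist≤crossingBound) , closedForm
  where
  attained : Σ (LinExt n) λ L₁ → Σ (LinExt n) λ L₂ → dist L₁ L₂ ≡ crossingBound n 0
  attained = lexExt n , colexExt n
           , trans (dist-lexExt-colexExt n) (lexColexDiscordances≡crossingBound-0 n)
  closedForm : 4 * crossingBound n 0 + (n + 1) * 2 ^ n ≡ 2 ^ (2 * n)
  closedForm = trans (4*crossingBound-0+[n+1]*2^n≡4^n n) (^-*-assoc 2 2 n)
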